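{- Let $P=NS^{\alpha_1}\cdots NS^{\alpha_n}$ and $Q=NS^{\beta_1}\cdots NS^{\beta_n}$ be Dyck paths of size $n$. Then $P$ is covered by $Q$ in the Kreweras lattice $\mathcal L^K_n$ if and only if $Q$ is obtained from $P$ by swapping a non-empty descent with a Dyck subpath following it, that is, there are indices $1\le i<j\le n$ with $\alpha_i>0$ and $i\preceq_P j$ such that $\beta_i=0$, $\beta_j=\alpha_i+\alpha_j$ and $\beta_k=\alpha_k$ for all $k\ne i,j$.
   Context: A Dyck path of size $n$ is a word in $N$ ($+1$) and $S$ ($-1$) with $n$ letters of each kind such that every prefix has at least as many $N$ as $S$; it is written uniquely $P=NS^{\alpha_1}\cdots NS^{\alpha_n}$, $\alpha_i\ge0$. For $0\le i\le n$, $e_i(P)=i-\sum_{j\le i}\alpha_j$. For $0\le i\le j\le n$, write $i\preceq_P j$ if $e_i(P)\ge e_j(P)$ and $e_i(P)\le e_k(P)$ for all $i<k<j$. A partition of $\{1,\dots,n\}$ is non-crossing if whenever $i<j<k<l$ with $i,k$ in one class and $j,l$ in one class, these classes coincide. The Kreweras lattice on non-crossing partitions of $\{1,\dots,n\}$ is the refinement order ($\pi\le\pi'$ iff each class of $\pi$ lies in a class of $\pi'$). $\theta$ maps a non-crossing partition $\pi$ to $NS^{\alpha_1}\cdots NS^{\alpha_n}$ where $\alpha_i$ is the size of the class of $i$ if $i$ is maximal in its class and $0$ otherwise; it is a bijection onto Dyck paths of size $n$. $\mathcal L^K_n$ is the transport of the Kreweras lattice to Dyck paths via $\theta$. -}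

module Defs where

open import Data.Nat using (ℕ; zero; suc; _+_; _≤_; _<_; _≡ᵇ_)
open import Data.Integer as ℤ using (ℤ; +_; _-_)
open import Data.Fin as Fin using (Fin; toℕ)
open import Data.Fin.Properties using (_≟_)
open import Data.Vec using (Vec; []; _∷_; tabulate; lookup)
open import Data.List using (List; length; filter; allFin)
open import Data.Bool using (if_then_else_)
open import Data.Product using (Σ; ∃; _×_; _,_)
open import Relation.Nullary using (¬_)
open import Relation.Nullary.Decidable using (_×-dec_)
open import Relation.Binary.PropositionalEquality using (_≡_; _≢_)

-- A Dyck path of size n is encoded by its exponent vector (α₁,…,αₙ),
-- P = N S^α₁ ⋯ N S^αₙ.  Index k : Fin n (0-based) stands for k+1.

psum : ∀ {n} → Vec ℕ n → ℕ → ℕ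
psum _ zero = zero
psum [] (suc i) = zero
psum (x ∷ xs) (suc i) = x + psum xs i

-- The word N S^α₁ ⋯ N S^αₙ is a Dyck path: n letters of each kind and
-- every prefix has at least as many N as S (it suffices to check the
-- prefixes ending after each block N S^αᵢ).
IsDyck : ∀ {n} → Vec ℕ n → Set
IsDyck {n} α = (∀ i → i ≤ n → psum α i ≤ i) × psum α n ≡ n

e : ∀ {n} → Vec ℕ n → ℕ → ℤ
e α i = + i - + psum α i

_⪯[_]_ : ∀ {n} → ℕ → Vec ℕ n → ℕ → Set
i ⪯[ α ] j = i ≤ j × e α j ℤ.≤ e α i × (∀ k → i < k → k < j → e α i ℤ.≤ e α k)

-- Set partitions of {1,…,n} given by a block-labelling:
-- x and y lie in the same class iff they have the same label.
Labelling : ℕ → Set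
Labelling n = Fin n → Fin n

IsNonCrossing : ∀ {n} → Labelling n → Set
IsNonCrossing {n} π = ∀ (i j k l : Fin n) → i Fin.< j → j Fin.< k → k Fin.< l →
  π i ≡ π k → π j ≡ π l → π i ≡ π j

NCPartition : ℕ → Set
NCPartition n = Σ (Labelling n) IsNonCrossing

Refines : ∀ {n} → NCPartition n → NCPartition n → Set
Refines {n} (π , _) (π' , _) = ∀ (x y : Fin n) → π x ≡ π y → π' x ≡ π' y

classSize : ∀ {n} → Labelling n → Fin n → ℕ
classSize {n} π i = length (filter (λ j → π j ≟ π i) (allFin n))

laterInClass : ∀ {n} → Labelling n → Fin n → ℕ
laterInClass {n} π i = length (filter (λ j → (π j ≟ π i) ×-dec (i Fin.<? j)) (allFin n))

θ : ∀ {n} → NCPartition n → Vec ℕ n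
θ (π , _) = tabulate (λ i → if laterInClass π i ≡ᵇ 0 then classSize π i else 0)

-- The Kreweras order transported to Dyck paths via θ
_≤K_ : ∀ {n} → Vec ℕ n → Vec ℕ n → Set
_≤K_ {n} α β = ∃ λ (π : NCPartition n) → ∃ λ (π' : NCPartition n) →
  θ π ≡ α × θ π' ≡ β × Refines π π'

_<K_ : ∀ {n} → Vec ℕ n → Vec ℕ n → Set
α <K β = α ≤K β × α ≢ β

_⋖K_ : ∀ {n} → Vec ℕ n → Vec ℕ n → Set
_⋖K_ {n} α β = α <K β × ¬ (∃ λ (γ : Vec ℕ n) → IsDyck γ × α <K γ × γ <K β)

-- A non-crossing partition is determined by the map sending each element to the maximum
-- of its class, and θ reads this map off the Dyck path: the maximum of the class of y is the
-- block containing the down step matched with the up step opening block y, and the height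
-- after k blocks counts the classes that straddle k. Hence θ is a bijection and the Kreweras
-- order becomes refinement of the kernels of these "closer" maps. When i ⪯_P j, moving the
-- descent S^{α_i} behind the Dyck factor that follows it changes the closer map only by
-- sending i to j: it merges the class with maximum i into the class with maximum j, which is
-- a cover. Conversely, if P ⋖ Q, let b be the maximum of a Q-class that is not a P-class and
-- a the largest element of that Q-class outside the P-class of b. Then a is a P-class
-- maximum, a+1 ⪯_P b+1 holds because Q is non-crossing, and swapping at (a, b) gives a
-- path strictly above P and weakly below Q, hence equal to Q.

module Submission where

open import Defs
open import Level using (0ℓ)
open import Data.Nat as ℕ using (ℕ; zero; suc; _+_; _∸_; _≤_; _<_; _>_; z≤n; s≤s; _≤?_; _<?_)
open import Data.Nat.Properties
open import Data.Fin as Fin using (Fin; toℕ; zero; suc)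
import Data.Fin.Properties as Finₚ
open import Data.Vec using (Vec; []; _∷_; lookup; _[_]≔_)
import Data.Vec.Properties as Vecₚ
import Data.List as List
open import Data.Product using (∃; ∃₂; _×_; _,_; proj₁; proj₂)
open import Data.Sum using (_⊎_; inj₁; inj₂)
open import Data.Empty using (⊥; ⊥-elim)
open import Function using (_∘_)
open import Data.Bool using (if_then_else_)
open import Function.Bundles using (_⇔_; mk⇔)
open import Relation.Nullary using (Dec; yes; no; ¬_)
open import Relation.Nullary.Decidable using (_×-dec_; ¬?; decidable-stable)
open import Relation.Unary using (Pred; Decidable; _⊆_; _∪_; _∩_; Empty; Satisfiable)
open import Relation.Unary.Properties using (_∪?_; _∩?_)
open import Data.Integer as ℤ using (ℤ)
import Data.Integer.Properties as ℤₚ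
open import Relation.Binary.Definitions using (tri<; tri≈; tri>)
open import Relation.Binary.PropositionalEquality

count : ∀ {n} {P : Pred (Fin n) 0ℓ} → Decidable P → ℕ
count {zero} P? = 0
count {suc n} P? with P? zero
... | yes _ = suc (count (λ x → P? (suc x)))
... | no _ = count (λ x → P? (suc x))

count-mono : ∀ {n} {P Q : Pred (Fin n) 0ℓ} (P? : Decidable P) (Q? : Decidable Q) →
  P ⊆ Q → count P? ≤ count Q?
count-mono {zero} _ _ _ = z≤n
count-mono {suc n} P? Q? P⊆Q with P? zero | Q? zero
... | yes p | no ¬q = ⊥-elim (¬q (P⊆Q p))
... | yes _ | yes _ = s≤s (count-mono (P? ∘ suc) (Q? ∘ suc) P⊆Q)
... | no _  | yes _ = m≤n⇒m≤1+n (count-mono (P? ∘ suc) (Q? ∘ suc) P⊆Q)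
... | no _  | no _  = count-mono (P? ∘ suc) (Q? ∘ suc) P⊆Q

count-cong : ∀ {n} {P Q : Pred (Fin n) 0ℓ} (P? : Decidable P) (Q? : Decidable Q) →
  P ⊆ Q → Q ⊆ P → count P? ≡ count Q?
count-cong P? Q? P⊆Q Q⊆P = ≤-antisym (count-mono P? Q? P⊆Q) (count-mono Q? P? Q⊆P)

count-strictMono : ∀ {n} {P Q : Pred (Fin n) 0ℓ} (P? : Decidable P) (Q? : Decidable Q) →
  P ⊆ Q → ∀ {x} → Q x → ¬ P x → count P? < count Q?
count-strictMono {suc n} P? Q? P⊆Q {x} qx ¬px with P? zero | Q? zero | x
... | yes p | no ¬q | _     = ⊥-elim (¬q (P⊆Q p))
... | yes p | _     | zero  = ⊥-elim (¬px p)
... | no _  | no ¬q | zero  = ⊥-elim (¬q qx)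
... | no _  | yes _ | zero  = s≤s (count-mono (P? ∘ suc) (Q? ∘ suc) P⊆Q)
... | yes _ | yes _ | suc x = s≤s (count-strictMono (P? ∘ suc) (Q? ∘ suc) P⊆Q qx ¬px)
... | no _  | yes _ | suc x = m≤n⇒m≤1+n (count-strictMono (P? ∘ suc) (Q? ∘ suc) P⊆Q qx ¬px)
... | no _  | no _  | suc x = count-strictMono (P? ∘ suc) (Q? ∘ suc) P⊆Q qx ¬px

count-∪ : ∀ {n} {R S : Pred (Fin n) 0ℓ} (R? : Decidable R) (S? : Decidable S) →
  Empty (R ∩ S) → count (R? ∪? S?) ≡ count R? + count S?
count-∪ {zero} _ _ _ = refl
count-∪ {suc n} R? S? disjoint with R? zero | S? zero
... | yes r | yes s = ⊥-elim (disjoint zero (r , s))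
... | yes _ | no _  = cong suc (count-∪ (R? ∘ suc) (S? ∘ suc) (disjoint ∘ suc))
... | no _  | yes _ = trans (cong suc (count-∪ (R? ∘ suc) (S? ∘ suc) (disjoint ∘ suc))) (sym (+-suc _ _))
... | no _  | no _  = count-∪ (R? ∘ suc) (S? ∘ suc) (disjoint ∘ suc)

count-partition : ∀ {n} {P R S : Pred (Fin n) 0ℓ} (P? : Decidable P) (R? : Decidable R) (S? : Decidable S) →
  P ⊆ R ∪ S → R ∪ S ⊆ P → Empty (R ∩ S) → count P? ≡ count R? + count S?
count-partition P? R? S? P⊆R∪S R∪S⊆P disjoint =
  trans (count-cong P? (R? ∪? S?) P⊆R∪S R∪S⊆P) (count-∪ R? S? disjoint)

count-empty : ∀ {n} {P : Pred (Fin n) 0ℓ} (P? : Decidable P) → Empty P → count P? ≡ 0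
count-empty {zero} _ _ = refl
count-empty {suc n} P? empty with P? zero
... | yes p = ⊥-elim (empty zero p)
... | no _  = count-empty (P? ∘ suc) (empty ∘ suc)

count-satisfiable : ∀ {n} {P : Pred (Fin n) 0ℓ} (P? : Decidable P) → Satisfiable P → 0 < count P?
count-satisfiable {suc n} P? (x , px) with P? zero | x
... | yes _ | _     = s≤s z≤n
... | no ¬p | zero  = ⊥-elim (¬p px)
... | no _  | suc x = count-satisfiable (P? ∘ suc) (x , px)

count-singleton : ∀ {n} (x : Fin n) → count (Finₚ._≟ x) ≡ 1
count-singleton {suc n} zero = cong suc (count-empty {n} ((Finₚ._≟ zero) ∘ suc) (λ y ()))
count-singleton {suc n} (suc x) =
  trans (count-cong ((Finₚ._≟ suc x) ∘ suc) (Finₚ._≟ x) Finₚ.suc-injective (cong suc)) (count-singleton x)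

count-below : ∀ {n} k → k ≤ n → count {n} (λ y → toℕ y <? k) ≡ k
count-below {n} zero _ = count-empty {n} (λ y → toℕ y <? zero) (λ y ())
count-below {suc n} (suc k) (s≤s k≤n) =
  cong suc (trans (count-cong {n} ((λ y → toℕ y <? suc k) ∘ suc) (λ y → toℕ y <? k) ≤-pred s≤s) (count-below k k≤n))

length-filter-tabulate : ∀ {n} {A : Set} (f : Fin n → A) {P : Pred A 0ℓ} (P? : Decidable P) →
  List.length (List.filter P? (List.tabulate f)) ≡ count (P? ∘ f)
length-filter-tabulate {zero} _ _ = refl
length-filter-tabulate {suc n} f P? with P? (f zero)
... | yes _ = cong suc (length-filter-tabulate (f ∘ suc) P?)
... | no _  = length-filter-tabulate (f ∘ suc) P?

least : ∀ {n} {P : Pred (Fin n) 0ℓ} → Decidable P → Satisfiable P →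
  ∃ λ z → P z × (∀ {w} → P w → z Fin.≤ w)
least {suc n} P? (x , px) with P? zero | x
... | yes p0 | _     = zero , p0 , λ _ → z≤n
... | no ¬p0 | zero  = ⊥-elim (¬p0 px)
... | no ¬p0 | suc x with least (P? ∘ suc) (x , px)
...   | z , pz , z≤ = suc z , pz , λ { {zero} p0 → ⊥-elim (¬p0 p0) ; {suc w} pw → s≤s (z≤ pw) }

greatest : ∀ {n} {P : Pred (Fin n) 0ℓ} → Decidable P → Satisfiable P →
  ∃ λ z → P z × (∀ {w} → P w → w Fin.≤ z)
greatest {suc n} P? (x , px) with Finₚ.any? (P? ∘ suc)
... | yes later with greatest (P? ∘ suc) later
...   | z , pz , ≤z = suc z , pz , λ { {zero} _ → z≤n ; {suc w} pw → s≤s (≤z pw) }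
greatest {suc n} P? (zero , p0)  | no none = zero , p0 , λ { {zero} _ → z≤n ; {suc w} pw → ⊥-elim (none (w , pw)) }
greatest {suc n} P? (suc x , px) | no none = ⊥-elim (none (x , px))

lookup-extensional : ∀ {n} {A : Set} (u v : Vec A n) → (∀ i → lookup u i ≡ lookup v i) → u ≡ v
lookup-extensional u v eq =
  trans (sym (Vecₚ.tabulate∘lookup u)) (trans (Vecₚ.tabulate-cong eq) (Vecₚ.tabulate∘lookup v))

psum-suc : ∀ {n} (v : Vec ℕ n) (x : Fin n) → psum v (suc (toℕ x)) ≡ psum v (toℕ x) + lookup v x
psum-suc (a ∷ v) zero = +-identityʳ a
psum-suc (a ∷ v) (suc x) = trans (cong (a +_) (psum-suc v x)) (sym (+-assoc a _ _))

psum-beyond : ∀ {n} (v : Vec ℕ n) k → n ≤ k → psum v k ≡ psum v n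
psum-beyond [] zero _ = refl
psum-beyond [] (suc k) _ = refl
psum-beyond (a ∷ v) (suc k) (s≤s n≤k) = cong (a +_) (psum-beyond v k n≤k)

psum-injective : ∀ {n} (u v : Vec ℕ n) → (∀ k → k ≤ n → psum u k ≡ psum v k) → u ≡ v
psum-injective {n} u v eq = lookup-extensional u v λ x →
  +-cancelˡ-≡ (psum u (toℕ x)) _ _ (begin
    psum u (toℕ x) + lookup u x   ≡⟨ sym (psum-suc u x) ⟩
    psum u (suc (toℕ x))          ≡⟨ eq (suc (toℕ x)) (Finₚ.toℕ<n x) ⟩
    psum v (suc (toℕ x))          ≡⟨ psum-suc v x ⟩
    psum v (toℕ x) + lookup v x   ≡⟨ cong (_+ lookup v x) (sym (eq (toℕ x) (<⇒≤ (Finₚ.toℕ<n x)))) ⟩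
    psum u (toℕ x) + lookup v x   ∎)
  where open ≡-Reasoning

psum-suc-fromℕ< : ∀ {n} (v : Vec ℕ n) {k} (k<n : k < n) →
  psum v (suc k) ≡ psum v k + lookup v (Fin.fromℕ< k<n)
psum-suc-fromℕ< v k<n =
  subst (λ t → psum v (suc t) ≡ psum v t + lookup v (Fin.fromℕ< k<n)) (Finₚ.toℕ-fromℕ< k<n) (psum-suc v _)

psum-agree : ∀ {n} (u v : Vec ℕ n) {c m m'} → m ≤ m' → m' ≤ n →
  (∀ x → m ≤ toℕ x → toℕ x < m' → lookup u x ≡ lookup v x) →
  psum u m + c ≡ psum v m → psum u m' + c ≡ psum v m'
psum-agree u v {m' = zero} z≤n _ _ base = base
psum-agree u v {c} {m} {suc k} m≤1+k 1+k≤n agree base with m≤n⇒m<n∨m≡n m≤1+k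
... | inj₂ refl = base
... | inj₁ m<1+k = begin
  psum u (suc k) + c         ≡⟨ cong (_+ c) (psum-suc-fromℕ< u 1+k≤n) ⟩
  psum u k + uₖ + c          ≡⟨ +-assoc (psum u k) uₖ c ⟩
  psum u k + (uₖ + c)        ≡⟨ cong (psum u k +_) (+-comm uₖ c) ⟩
  psum u k + (c + uₖ)        ≡⟨ sym (+-assoc (psum u k) c uₖ) ⟩
  psum u k + c + uₖ          ≡⟨ cong₂ _+_ ih (agree x (subst (m ≤_) (sym toℕx) (≤-pred m<1+k)) (s≤s (≤-reflexive toℕx))) ⟩
  psum v k + lookup v x      ≡⟨ sym (psum-suc-fromℕ< v 1+k≤n) ⟩
  psum v (suc k)             ∎
  where
  open ≡-Reasoning
  x = Fin.fromℕ< 1+k≤n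
  uₖ = lookup u x
  toℕx : toℕ x ≡ k
  toℕx = Finₚ.toℕ-fromℕ< 1+k≤n
  ih : psum u k + c ≡ psum v k
  ih = psum-agree u v (≤-pred m<1+k) (<⇒≤ 1+k≤n) (λ y m≤y y<k → agree y m≤y (m≤n⇒m≤1+n y<k)) base

psum≤ : ∀ {n} {α : Vec ℕ n} → IsDyck α → ∀ k → psum α k ≤ k
psum≤ {n} {α} (prefix , total) k with ≤-total k n
... | inj₁ k≤n = prefix k k≤n
... | inj₂ n≤k = ≤-trans (≤-reflexive (trans (psum-beyond α k n≤k) total)) n≤k

-- e α k in ℕ; the subtraction does not truncate on Dyck paths (psum≤).
height : ∀ {n} → Vec ℕ n → ℕ → ℕ
height α k = k ∸ psum α k

height+psum : ∀ {n} {α : Vec ℕ n} → IsDyck α → ∀ k → height α k + psum α k ≡ k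
height+psum D k = m∸n+n≡m (psum≤ D k)

height-final : ∀ {n} {α : Vec ℕ n} → IsDyck α → height α n ≡ 0
height-final {n} (_ , total) = trans (cong (n ∸_) total) (n∸n≡0 n)

height-suc : ∀ {n} {α : Vec ℕ n} → IsDyck α → (x : Fin n) →
  height α (suc (toℕ x)) + lookup α x ≡ suc (height α (toℕ x))
height-suc {α = α} D x = +-cancelʳ-≡ p _ _ (begin
  height α (suc (toℕ x)) + a + p    ≡⟨ +-assoc (height α (suc (toℕ x))) a p ⟩
  height α (suc (toℕ x)) + (a + p)  ≡⟨ cong (height α (suc (toℕ x)) +_) (trans (+-comm a p) (sym (psum-suc α x))) ⟩
  height α (suc (toℕ x)) + psum α (suc (toℕ x)) ≡⟨ height+psum D (suc (toℕ x)) ⟩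
  suc (toℕ x)                       ≡⟨ cong suc (sym (height+psum D (toℕ x))) ⟩
  suc (height α (toℕ x)) + p        ∎)
  where
  open ≡-Reasoning
  p = psum α (toℕ x)
  a = lookup α x

e≡height : ∀ {n} {α : Vec ℕ n} → IsDyck α → ∀ k → e α k ≡ ℤ.+ height α k
e≡height {α = α} D k = trans (ℤₚ.m-n≡m⊖n k (psum α k)) (ℤₚ.⊖-≥ (psum≤ D k))

-- First returns and the closer map

-- Blocks are 0-based. Block y is opened by an up step from height e_y = height α y, and
-- block b contains the matching down step: the first block after which the height is
-- back to at most e_y.
record FirstReturn {n} (α : Vec ℕ n) (y b : ℕ) : Set where
  constructor firstReturn
  field
    start≤end : y ≤ b
    returns : height α (suc b) ≤ height α y
    stays-above : ∀ m → y < m → m ≤ b → height α y < height α m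

open FirstReturn

firstReturn-unique : ∀ {n} {α : Vec ℕ n} {y b b'} → FirstReturn α y b → FirstReturn α y b' → b ≡ b'
firstReturn-unique {b = b} {b'} r r' with <-cmp b b'
... | tri≈ _ b≡b' _ = b≡b'
... | tri< b<b' _ _ = ⊥-elim (<⇒≱ (stays-above r' (suc b) (s≤s (start≤end r)) b<b') (returns r))
... | tri> _ _ b'<b = ⊥-elim (<⇒≱ (stays-above r (suc b') (s≤s (start≤end r')) b'<b) (returns r'))

firstReturn-end : ∀ {n} {α : Vec ℕ n} {y b} → FirstReturn α y b → FirstReturn α b b
firstReturn-end {b = b} r@(firstReturn y≤b ret above) with m≤n⇒m<n∨m≡n y≤b
... | inj₂ refl = r
... | inj₁ y<b = firstReturn ≤-refl (<⇒≤ (≤-<-trans ret (above b y<b ≤-refl))) (λ m b<m m≤b → ⊥-elim (<⇒≱ b<m m≤b))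

firstReturn-exists : ∀ {n} {α : Vec ℕ n} → IsDyck α → (y : Fin n) → ∃ λ (b : Fin n) → FirstReturn α (toℕ y) (toℕ b)
firstReturn-exists {suc n} {α} D y with least Returned? (Fin.fromℕ n , lastReturned)
  where
  Returned : Pred (Fin (suc n)) 0ℓ
  Returned b = toℕ y ≤ toℕ b × height α (suc (toℕ b)) ≤ height α (toℕ y)
  Returned? : Decidable Returned
  Returned? b = (toℕ y ≤? toℕ b) ×-dec (height α (suc (toℕ b)) ≤? height α (toℕ y))
  lastReturned : Returned (Fin.fromℕ n)
  lastReturned rewrite Finₚ.toℕ-fromℕ n = ≤-pred (Finₚ.toℕ<n y) , ≤-trans (≤-reflexive (height-final D)) z≤n
... | b , (y≤b , ret) , b≤ = b , firstReturn y≤b ret above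
  where
  above : ∀ m → toℕ y < m → m ≤ toℕ b → height α (toℕ y) < height α m
  above (suc j) (s≤s y≤j) j<b = ≰⇒> λ returned →
    let j<n = <-≤-trans j<b (<⇒≤ (Finₚ.toℕ<n b))
        toℕj = Finₚ.toℕ-fromℕ< j<n
        jReturned = subst (λ t → toℕ y ≤ t × height α (suc t) ≤ height α (toℕ y)) (sym toℕj) (y≤j , returned)
    in <⇒≱ j<b (subst (toℕ b ≤_) toℕj (b≤ jReturned))

module _ {n} {α : Vec ℕ n} (D : IsDyck α) where

  closer : Fin n → Fin n
  closer y = proj₁ (firstReturn-exists D y)

  closer-firstReturn : ∀ y → FirstReturn α (toℕ y) (toℕ (closer y))
  closer-firstReturn y = proj₂ (firstReturn-exists D y)

  closer-unique : ∀ {y b} → FirstReturn α (toℕ y) (toℕ b) → closer y ≡ b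
  closer-unique r = Finₚ.toℕ-injective (firstReturn-unique (closer-firstReturn _) r)

  closer-idem : ∀ y → closer (closer y) ≡ closer y
  closer-idem y = closer-unique (firstReturn-end (closer-firstReturn y))

  y≤closer : ∀ y → y Fin.≤ closer y
  y≤closer y = start≤end (closer-firstReturn y)

  closer-nonCrossing : IsNonCrossing closer
  closer-nonCrossing i j k l i<j j<k k<l cᵢ≡cₖ cⱼ≡cₗ with <-cmp (toℕ (closer i)) (toℕ (closer j))
  ... | tri≈ _ cᵢ≡cⱼ _ = Finₚ.toℕ-injective cᵢ≡cⱼ
  ... | tri< cᵢ<cⱼ _ _ = ⊥-elim (<⇒≱ (<-trans
          (stays-above (closer-firstReturn i) (toℕ j) i<j (<⇒≤ (<-≤-trans j<k k≤cᵢ)))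
          (stays-above (closer-firstReturn j) (suc (toℕ (closer i))) (s≤s (<⇒≤ (<-≤-trans j<k k≤cᵢ))) cᵢ<cⱼ))
        (returns (closer-firstReturn i)))
    where
    k≤cᵢ : toℕ k ≤ toℕ (closer i)
    k≤cᵢ = subst (λ b → toℕ k ≤ toℕ b) (sym cᵢ≡cₖ) (y≤closer k)
  ... | tri> _ _ cⱼ<cᵢ = ⊥-elim (<⇒≱ (<-trans
          (stays-above (closer-firstReturn j) (toℕ k) j<k (<⇒≤ (<-≤-trans k<l l≤cⱼ)))
          (stays-above (subst (λ b → FirstReturn α (toℕ k) (toℕ b)) (sym cᵢ≡cₖ) (closer-firstReturn k))
            (suc (toℕ (closer j))) (s≤s (<⇒≤ (<-≤-trans k<l l≤cⱼ))) cⱼ<cᵢ))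
        (returns (closer-firstReturn j)))
    where
    l≤cⱼ : toℕ l ≤ toℕ (closer j)
    l≤cⱼ = subst (λ b → toℕ l ≤ toℕ b) (sym cⱼ≡cₗ) (y≤closer l)

  closerPartition : NCPartition n
  closerPartition = closer , closer-nonCrossing

record IsClassMax {n} (π : Labelling n) (M : Fin n → Fin n) : Set where
  field
    sameClass⇒ : ∀ {x y} → π x ≡ π y → M x ≡ M y
    ⇒sameClass : ∀ {x y} → M x ≡ M y → π x ≡ π y
    ≤max : ∀ y → y Fin.≤ M y
    max-idem : ∀ y → M (M y) ≡ M y

open IsClassMax

module _ {n} (π : Labelling n) where

  private
    maxOfClass : ∀ y → ∃ λ z → π z ≡ π y × (∀ {w} → π w ≡ π y → w Fin.≤ z)
    maxOfClass y = greatest (λ w → π w Finₚ.≟ π y) (y , refl)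

  classMax : Fin n → Fin n
  classMax y = proj₁ (maxOfClass y)

  classMax-sameClass : ∀ y → π (classMax y) ≡ π y
  classMax-sameClass y = proj₁ (proj₂ (maxOfClass y))

  ≤classMax : ∀ {y w} → π w ≡ π y → w Fin.≤ classMax y
  ≤classMax {y} = proj₂ (proj₂ (maxOfClass y))

  classMax-cong : ∀ {x y} → π x ≡ π y → classMax x ≡ classMax y
  classMax-cong {x} {y} πx≡πy = Finₚ.toℕ-injective (≤-antisym
    (≤classMax (trans (classMax-sameClass x) πx≡πy))
    (≤classMax (trans (classMax-sameClass y) (sym πx≡πy))))

  classMax-isClassMax : IsClassMax π classMax
  classMax-isClassMax = record
    { sameClass⇒ = classMax-cong
    ; ⇒sameClass = λ {x} {y} eq → trans (sym (classMax-sameClass x)) (trans (cong π eq) (classMax-sameClass y))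
    ; ≤max = λ y → ≤classMax refl
    ; max-idem = λ y → classMax-cong (classMax-sameClass y)
    }

  isClassMax-nonCrossing : ∀ {M} → IsNonCrossing π → IsClassMax π M → IsNonCrossing M
  isClassMax-nonCrossing nc isMax i j k l i<j j<k k<l Mᵢ≡Mₖ Mⱼ≡Mₗ =
    sameClass⇒ isMax (nc i j k l i<j j<k k<l (⇒sameClass isMax Mᵢ≡Mₖ) (⇒sameClass isMax Mⱼ≡Mₗ))

OpenAt : ∀ {n} → (Fin n → Fin n) → ℕ → Pred (Fin n) 0ℓ
OpenAt M k y = toℕ y < k × k ≤ toℕ (M y)

open? : ∀ {n} (M : Fin n → Fin n) k → Decidable (OpenAt M k)
open? M k y = (toℕ y <? k) ×-dec (k ≤? toℕ (M y))

module θ-ClassMax {n} (π : NCPartition n) {M : Fin n → Fin n} (isMax : IsClassMax (proj₁ π) M) where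

  private
    later? : ∀ x → Decidable (λ j → proj₁ π j ≡ proj₁ π x × x Fin.< j)
    later? x j = (proj₁ π j Finₚ.≟ proj₁ π x) ×-dec (x Fin.<? j)

  θ-lookup : ∀ x → lookup (θ π) x ≡ count (λ y → M y Finₚ.≟ x)
  θ-lookup x = trans (Vecₚ.lookup∘tabulate _ x) (byMax (M x Finₚ.≟ x))
    where
    later≡count : laterInClass (proj₁ π) x ≡ count (later? x)
    later≡count = length-filter-tabulate (λ j → j) (later? x)
    noLater : M x ≡ x → Empty (λ j → proj₁ π j ≡ proj₁ π x × x Fin.< j)
    noLater Mx≡x j (πj≡πx , x<j) =
      <⇒≱ x<j (≤-trans (≤max isMax j) (≤-reflexive (cong toℕ (trans (sameClass⇒ isMax πj≡πx) Mx≡x))))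
    byMax : Dec (M x ≡ x) →
      (if laterInClass (proj₁ π) x ℕ.≡ᵇ 0 then classSize (proj₁ π) x else 0) ≡ count (λ y → M y Finₚ.≟ x)
    byMax (yes Mx≡x) rewrite later≡count | count-empty (later? x) (noLater Mx≡x) =
      trans (length-filter-tabulate (λ j → j) (λ j → proj₁ π j Finₚ.≟ proj₁ π x))
            (count-cong (λ y → proj₁ π y Finₚ.≟ proj₁ π x) (λ y → M y Finₚ.≟ x)
                        (λ πy≡πx → trans (sameClass⇒ isMax πy≡πx) Mx≡x)
                        (λ My≡x → ⇒sameClass isMax (trans My≡x (sym Mx≡x))))
    byMax (no Mx≢x) with laterInClass (proj₁ π) x | later≡count
    ... | zero  | 0≡count = ⊥-elim (<-irrefl 0≡count (count-satisfiable (later? x)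
                              (M x , ⇒sameClass isMax (max-idem isMax x) , Finₚ.≤∧≢⇒< (≤max isMax x) (Mx≢x ∘ sym))))
    ... | suc _ | _ = sym (count-empty (λ y → M y Finₚ.≟ x)
                        λ y My≡x → Mx≢x (trans (cong M (sym My≡x)) (trans (max-idem isMax y) My≡x)))

  psum-θ : ∀ k → k ≤ n → psum (θ π) k ≡ count (λ y → toℕ (M y) <? k)
  psum-θ zero _ = sym (count-empty (λ y → toℕ (M y) <? 0) λ y ())
  psum-θ (suc k) k<n = begin
    psum (θ π) (suc k)                          ≡⟨ psum-suc-fromℕ< (θ π) k<n ⟩
    psum (θ π) k + lookup (θ π) x               ≡⟨ cong₂ _+_ (psum-θ k (<⇒≤ k<n)) (θ-lookup x) ⟩
    count (λ y → toℕ (M y) <? k) + count (λ y → M y Finₚ.≟ x)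
      ≡⟨ sym (count-partition (λ y → toℕ (M y) <? suc k) (λ y → toℕ (M y) <? k) (λ y → M y Finₚ.≟ x)
                              split merge disjoint) ⟩
    count (λ y → toℕ (M y) <? suc k)            ∎
    where
    open ≡-Reasoning
    x = Fin.fromℕ< k<n
    toℕx : toℕ x ≡ k
    toℕx = Finₚ.toℕ-fromℕ< k<n
    split : ∀ {y} → toℕ (M y) < suc k → toℕ (M y) < k ⊎ M y ≡ x
    split My<1+k with m≤n⇒m<n∨m≡n (≤-pred My<1+k)
    ... | inj₁ My<k = inj₁ My<k
    ... | inj₂ My≡k = inj₂ (Finₚ.toℕ-injective (trans My≡k (sym toℕx)))
    merge : ∀ {y} → toℕ (M y) < k ⊎ M y ≡ x → toℕ (M y) < suc k
    merge (inj₁ My<k) = m≤n⇒m≤1+n My<k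
    merge (inj₂ My≡x) = s≤s (≤-reflexive (trans (cong toℕ My≡x) toℕx))
    disjoint : Empty (λ y → toℕ (M y) < k × M y ≡ x)
    disjoint y (My<k , My≡x) = <-irrefl (trans (cong toℕ My≡x) toℕx) My<k

  psum+open : ∀ k → k ≤ n → psum (θ π) k + count (open? M k) ≡ k
  psum+open k k≤n = trans (cong (_+ count (open? M k)) (psum-θ k k≤n))
    (trans (sym (count-partition (λ y → toℕ y <? k) (λ y → toℕ (M y) <? k) (open? M k) split merge
                  (λ y (My<k , _ , k≤My) → <⇒≱ My<k k≤My)))
           (count-below k k≤n))
    where
    split : ∀ {y} → toℕ y < k → toℕ (M y) < k ⊎ OpenAt M k y
    split {y} y<k with toℕ (M y) <? k
    ... | yes My<k = inj₁ My<k
    ... | no My≮k = inj₂ (y<k , ≮⇒≥ My≮k)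
    merge : ∀ {y} → toℕ (M y) < k ⊎ OpenAt M k y → toℕ y < k
    merge {y} (inj₁ My<k) = ≤-<-trans (≤max isMax y) My<k
    merge (inj₂ (y<k , _)) = y<k

  height-θ : ∀ k → k ≤ n → height (θ π) k ≡ count (open? M k)
  height-θ k k≤n = trans (cong (_∸ psum (θ π) k) (sym (psum+open k k≤n))) (m+n∸m≡n (psum (θ π) k) _)

  private
    nonCrossing : IsNonCrossing M
    nonCrossing = isClassMax-nonCrossing (proj₁ π) (proj₂ π) isMax

  arc-nested : ∀ {y z} → y Fin.≤ z → z Fin.≤ M y → M z Fin.≤ M y
  arc-nested {y} {z} y≤z z≤My with m≤n⇒m<n∨m≡n z≤My | m≤n⇒m<n∨m≡n y≤z
  ... | inj₂ z≡My | _ = ≤-reflexive (cong toℕ (trans (cong M (Finₚ.toℕ-injective z≡My)) (max-idem isMax y)))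
  ... | inj₁ _    | inj₂ y≡z = ≤-reflexive (cong (toℕ ∘ M) (sym (Finₚ.toℕ-injective y≡z)))
  ... | inj₁ z<My | inj₁ y<z = ≮⇒≥ λ My<Mz → <-irrefl (cong toℕ
          (nonCrossing y z (M y) (M z) y<z z<My My<Mz (sym (max-idem isMax y)) (sym (max-idem isMax z))))
          My<Mz

  firstReturn-θ : ∀ y → FirstReturn (θ π) (toℕ y) (toℕ (M y))
  firstReturn-θ y = firstReturn (≤max isMax y) returns′ stays-above′
    where
    returns′ : height (θ π) (suc (toℕ (M y))) ≤ height (θ π) (toℕ y)
    returns′ rewrite height-θ (suc (toℕ (M y))) (Finₚ.toℕ<n (M y)) | height-θ (toℕ y) (<⇒≤ (Finₚ.toℕ<n y)) =
      count-mono (open? M _) (open? M _) λ {z} (z≤My , My<Mz) →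
        ≰⇒> (λ y≤z → <⇒≱ My<Mz (arc-nested y≤z (≤-pred z≤My))) , ≤-trans (≤max isMax y) (<⇒≤ My<Mz)
    stays-above′ : ∀ m → toℕ y < m → m ≤ toℕ (M y) → height (θ π) (toℕ y) < height (θ π) m
    stays-above′ m y<m m≤My
      rewrite height-θ m (≤-trans m≤My (<⇒≤ (Finₚ.toℕ<n (M y)))) | height-θ (toℕ y) (<⇒≤ (Finₚ.toℕ<n y)) =
      count-strictMono (open? M _) (open? M _)
        (λ {z} (z<y , y≤Mz) → <-trans z<y y<m , ≤-trans m≤My (arc-nested (<⇒≤ z<y) y≤Mz))
        (y<m , m≤My) (λ (y<y , _) → <-irrefl refl y<y)

module _ {n} {α : Vec ℕ n} (D : IsDyck α) where

  private
    c = closer D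
    h = height α

  open⇒below : ∀ {k y} → OpenAt c k y → h (toℕ y) < h k
  open⇒below {k} {y} (y<k , k≤cy) = stays-above (closer-firstReturn D y) k y<k k≤cy

  module _ {k} (k<n : k < n) where

    private
      x = Fin.fromℕ< k<n
      toℕx : toℕ x ≡ k
      toℕx = Finₚ.toℕ-fromℕ< k<n

    open-suc⇒ : ∀ {y} → OpenAt c (suc k) y → (OpenAt c k y ⊎ y ≡ x) × h (toℕ y) < h (suc k)
    open-suc⇒ {y} isOpen@(y<1+k , 1+k≤cy) with m≤n⇒m<n∨m≡n (≤-pred y<1+k)
    ... | inj₁ y<k = inj₁ (y<k , <⇒≤ 1+k≤cy) , open⇒below isOpen
    ... | inj₂ y≡k = inj₂ (Finₚ.toℕ-injective (trans y≡k (sym toℕx))) , open⇒below isOpen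

    ⇒open-suc : ∀ {y} → OpenAt c k y ⊎ y ≡ x → h (toℕ y) < h (suc k) → OpenAt c (suc k) y
    ⇒open-suc {y} (inj₁ (y<k , k≤cy)) below = m≤n⇒m≤1+n y<k , closesAfter k≤cy below
      where
      closesAfter : k ≤ toℕ (c y) → h (toℕ y) < h (suc k) → suc k ≤ toℕ (c y)
      closesAfter k≤cy below with m≤n⇒m<n∨m≡n k≤cy
      ... | inj₁ k<cy = k<cy
      ... | inj₂ k≡cy = ⊥-elim (<⇒≱ below (subst (λ b → h (suc b) ≤ h (toℕ y)) (sym k≡cy) (returns (closer-firstReturn D y))))
    ⇒open-suc {y} (inj₂ refl) below = s≤s (≤-reflexive toℕx) , ≰⇒> λ cx≤k →
      <⇒≱ below (subst (λ b → h (suc b) ≤ h (toℕ x)) (≤-antisym cx≤k (subst (_≤ toℕ (c x)) toℕx (y≤closer D x)))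
                       (returns (closer-firstReturn D x)))

  AtLeast : ℕ → Pred (Fin n) 0ℓ
  AtLeast t y = t ≤ h (toℕ y)

  atLeast? : ∀ t → Decidable (AtLeast t)
  atLeast? t y = t ≤? h (toℕ y)

  module _ {k} (k<n : k < n) where

    private
      x = Fin.fromℕ< k<n
      toℕx : toℕ x ≡ k
      toℕx = Finₚ.toℕ-fromℕ< k<n
      hx≡hk : h (toℕ x) ≡ h k
      hx≡hk = cong h toℕx
      x≮k : ∀ {y} → y ≡ x → ¬ toℕ y < k
      x≮k refl x<k = <-irrefl toℕx x<k

    count-open-up : ∀ t → h (suc k) ≡ suc (h k) →
      count (open? c (suc k) ∩? atLeast? t) ≡ count (open? c k ∩? atLeast? t) + count ((Finₚ._≟ x) ∩? atLeast? t)
    count-open-up t up = count-partition (open? c (suc k) ∩? atLeast? t) (open? c k ∩? atLeast? t) ((Finₚ._≟ x) ∩? atLeast? t)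
      (λ { (isOpen , t≤hy) → Data.Sum.map (_, t≤hy) (_, t≤hy) (proj₁ (open-suc⇒ k<n isOpen)) })
      (λ { (inj₁ (isOpen , t≤hy)) →
             ⇒open-suc k<n (inj₁ isOpen) (<-trans (open⇒below isOpen) (subst (h k <_) (sym up) ≤-refl)) , t≤hy
         ; (inj₂ (y≡x , t≤hy)) →
             ⇒open-suc k<n (inj₂ y≡x) (subst₂ _<_ (sym (trans (cong (h ∘ toℕ) y≡x) hx≡hk)) (sym up) ≤-refl) , t≤hy })
      (λ y (((y<k , _) , _) , y≡x , _) → x≮k y≡x y<k)

    count-open-down : ∀ {t} → h (suc k) ≤ h k → t ≤ h (suc k) →
      count (open? c k ∩? atLeast? t) ≡ count (open? c (suc k) ∩? atLeast? t) + count (open? c k ∩? atLeast? (h (suc k)))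
    count-open-down {t} down t≤u =
      count-partition (open? c k ∩? atLeast? t) (open? c (suc k) ∩? atLeast? t) (open? c k ∩? atLeast? (h (suc k)))
      (λ {y} (isOpen , t≤hy) → case (h (toℕ y) <? h (suc k)) isOpen t≤hy)
      (λ { (inj₁ (isOpen′ , t≤hy)) → stillOpen isOpen′ , t≤hy
         ; (inj₂ (isOpen , u≤hy)) → isOpen , ≤-trans t≤u u≤hy })
      (λ y ((isOpen′ , _) , (_ , u≤hy)) → <⇒≱ (open⇒below isOpen′) u≤hy)
      where
      case : ∀ {y} → Dec (h (toℕ y) < h (suc k)) → OpenAt c k y → AtLeast t y →
        (OpenAt c (suc k) y × AtLeast t y) ⊎ (OpenAt c k y × AtLeast (h (suc k)) y)
      case (yes below) isOpen t≤hy = inj₁ (⇒open-suc k<n (inj₁ isOpen) below , t≤hy)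
      case (no ¬below) isOpen _ = inj₂ (isOpen , ≮⇒≥ ¬below)
      stillOpen : ∀ {y} → OpenAt c (suc k) y → OpenAt c k y
      stillOpen isOpen′ with open-suc⇒ k<n isOpen′
      ... | inj₁ isOpen , _ = isOpen
      ... | inj₂ y≡x , below = ⊥-elim (<⇒≱ below (≤-trans down (≤-reflexive (sym (trans (cong (h ∘ toℕ) y≡x) hx≡hk)))))


    up-or-down : h (suc k) ≡ suc (h k) ⊎ h (suc k) ≤ h k
    up-or-down with lookup α x | subst (λ m → h (suc m) + lookup α x ≡ suc (h m)) toℕx (height-suc D x)
    ... | zero  | step = inj₁ (trans (sym (+-identityʳ _)) step)
    ... | suc _ | step = inj₂ (≤-pred (subst (h (suc k) <_) step (m<m+n (h (suc k)) (s≤s z≤n))))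

    count-x-atLeast : ∀ t → h k ∸ t + count ((Finₚ._≟ x) ∩? atLeast? t) ≡ suc (h k) ∸ t
    count-x-atLeast t with t ≤? h k
    ... | yes t≤hk = begin
      h k ∸ t + count ((Finₚ._≟ x) ∩? atLeast? t)
        ≡⟨ cong (h k ∸ t +_) (trans (count-cong _ (Finₚ._≟ x) proj₁ at-x) (count-singleton x)) ⟩
      h k ∸ t + 1                                 ≡⟨ +-comm (h k ∸ t) 1 ⟩
      suc (h k ∸ t)                               ≡⟨ sym (+-∸-assoc 1 t≤hk) ⟩
      suc (h k) ∸ t                               ∎
      where
      open ≡-Reasoning
      at-x : ∀ {y} → y ≡ x → y ≡ x × AtLeast t y
      at-x refl = refl , subst (t ≤_) (sym hx≡hk) t≤hk
    ... | no t≰hk = begin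
      h k ∸ t + count ((Finₚ._≟ x) ∩? atLeast? t)
        ≡⟨ cong₂ _+_ (m≤n⇒m∸n≡0 (<⇒≤ hk<t)) (count-empty ((Finₚ._≟ x) ∩? atLeast? t) notAtLeast) ⟩
      0                                           ≡⟨ sym (m≤n⇒m∸n≡0 hk<t) ⟩
      suc (h k) ∸ t                               ∎
      where
      open ≡-Reasoning
      hk<t = ≰⇒> t≰hk
      notAtLeast : Empty (λ y → y ≡ x × AtLeast t y)
      notAtLeast y (refl , t≤hx) = t≰hk (subst (t ≤_) hx≡hk t≤hx)

    openAtLeast-up : h (suc k) ≡ suc (h k) → (∀ t → count (open? c k ∩? atLeast? t) ≡ h k ∸ t) →
      ∀ t → count (open? c (suc k) ∩? atLeast? t) ≡ h (suc k) ∸ t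
    openAtLeast-up up ih t = begin
      count (open? c (suc k) ∩? atLeast? t)                               ≡⟨ count-open-up t up ⟩
      count (open? c k ∩? atLeast? t) + count ((Finₚ._≟ x) ∩? atLeast? t)
        ≡⟨ cong (_+ count ((Finₚ._≟ x) ∩? atLeast? t)) (ih t) ⟩
      h k ∸ t + count ((Finₚ._≟ x) ∩? atLeast? t)                         ≡⟨ count-x-atLeast t ⟩
      suc (h k) ∸ t                                                       ≡⟨ cong (_∸ t) (sym up) ⟩
      h (suc k) ∸ t                                                       ∎
      where open ≡-Reasoning

    openAtLeast-down : h (suc k) ≤ h k → (∀ t → count (open? c k ∩? atLeast? t) ≡ h k ∸ t) →
      ∀ t → count (open? c (suc k) ∩? atLeast? t) ≡ h (suc k) ∸ t
    openAtLeast-down down ih t with t ≤? h (suc k)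
    ... | no t≰u = trans (count-empty (open? c (suc k) ∩? atLeast? t)
                                      (λ y (isOpen , t≤hy) → t≰u (≤-trans t≤hy (<⇒≤ (open⇒below isOpen)))))
                         (sym (m≤n⇒m∸n≡0 (<⇒≤ (≰⇒> t≰u))))
    ... | yes t≤u = +-cancelʳ-≡ (h k ∸ u) _ _ (begin
      count (open? c (suc k) ∩? atLeast? t) + (h k ∸ u)  ≡⟨ cong (count (open? c (suc k) ∩? atLeast? t) +_) (sym (ih u)) ⟩
      count (open? c (suc k) ∩? atLeast? t) + count (open? c k ∩? atLeast? u) ≡⟨ sym (count-open-down down t≤u) ⟩
      count (open? c k ∩? atLeast? t)                     ≡⟨ ih t ⟩
      h k ∸ t                                             ≡⟨ cong (_∸ t) (sym (m∸n+n≡m down)) ⟩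
      (h k ∸ u) + u ∸ t                                   ≡⟨ +-∸-assoc (h k ∸ u) t≤u ⟩
      (h k ∸ u) + (u ∸ t)                                 ≡⟨ +-comm (h k ∸ u) (u ∸ t) ⟩
      u ∸ t + (h k ∸ u)                                   ∎)
      where
      open ≡-Reasoning
      u = h (suc k)

  -- The elements open at k are the unmatched up steps before position k;
  -- their heights are exactly 0, 1, …, e_k − 1.
  count-openAtLeast : ∀ k → k ≤ n → ∀ t → count (open? c k ∩? atLeast? t) ≡ h k ∸ t
  count-openAtLeast zero _ t = trans (count-empty (open? c 0 ∩? atLeast? t) (λ { y ((() , _) , _) })) (sym (0∸n≡0 t))
  count-openAtLeast (suc k) k<n with up-or-down k<n
  ... | inj₁ up   = openAtLeast-up k<n up (count-openAtLeast k (<⇒≤ k<n))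
  ... | inj₂ down = openAtLeast-down k<n down (count-openAtLeast k (<⇒≤ k<n))

  height-closer : ∀ k → k ≤ n → h k ≡ count (open? c k)
  height-closer k k≤n = sym (trans (count-cong (open? c k) (open? c k ∩? atLeast? 0) (_, z≤n) proj₁)
                                   (count-openAtLeast k k≤n 0))

  closer-isClassMax : IsClassMax c c
  closer-isClassMax = record
    { sameClass⇒ = λ eq → eq ; ⇒sameClass = λ eq → eq ; ≤max = y≤closer D ; max-idem = closer-idem D }

  closer-nested : ∀ {y z} → y Fin.≤ z → z Fin.≤ c y → c z Fin.≤ c y
  closer-nested = θ-ClassMax.arc-nested (closerPartition D) closer-isClassMax

  θ-closerPartition : θ (closerPartition D) ≡ α
  θ-closerPartition = psum-injective _ α λ k k≤n → +-cancelʳ-≡ (h k) _ _ (begin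
    psum (θ (closerPartition D)) k + h k                ≡⟨ cong (psum (θ (closerPartition D)) k +_) (height-closer k k≤n) ⟩
    psum (θ (closerPartition D)) k + count (open? c k)  ≡⟨ θ-ClassMax.psum+open (closerPartition D) closer-isClassMax k k≤n ⟩
    k                                                   ≡⟨ sym (height+psum D k) ⟩
    h k + psum α k                                      ≡⟨ +-comm (h k) (psum α k) ⟩
    psum α k + h k                                      ∎)
    where open ≡-Reasoning

  lookup-closer : ∀ x → lookup α x ≡ count (λ y → c y Finₚ.≟ x)
  lookup-closer x = subst (λ v → lookup v x ≡ count (λ y → c y Finₚ.≟ x)) θ-closerPartition
    (θ-ClassMax.θ-lookup (closerPartition D) closer-isClassMax x)

  θπ≡α⇒closer-isClassMax : (π : NCPartition n) → θ π ≡ α → IsClassMax (proj₁ π) c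
  θπ≡α⇒closer-isClassMax π θπ≡α = record
    { sameClass⇒ = λ {x} {y} eq → trans (sym (max≡closer x)) (trans (sameClass⇒ isMax eq) (max≡closer y))
    ; ⇒sameClass = λ {x} {y} eq → ⇒sameClass isMax (trans (max≡closer x) (trans eq (sym (max≡closer y))))
    ; ≤max = y≤closer D
    ; max-idem = closer-idem D
    }
    where
    isMax = classMax-isClassMax (proj₁ π)
    max≡closer : ∀ y → classMax (proj₁ π) y ≡ c y
    max≡closer y = sym (closer-unique D (subst (λ v → FirstReturn v (toℕ y) (toℕ (classMax (proj₁ π) y))) θπ≡α
                                                 (θ-ClassMax.firstReturn-θ π isMax y)))

-- The Kreweras order as refinement of closer maps

Finer : ∀ {n} → (Fin n → Fin n) → (Fin n → Fin n) → Set
Finer M K = ∀ {x y} → M x ≡ M y → K x ≡ K y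

finer-witness : ∀ {n} (M K : Fin n → Fin n) → ¬ Finer M K → ∃₂ λ x y → M x ≡ M y × K x ≢ K y
finer-witness M K ¬finer with Finₚ.any? (λ x → Finₚ.any? λ y → (M x Finₚ.≟ M y) ×-dec ¬? (K x Finₚ.≟ K y))
... | yes (x , y , witness) = x , y , witness
... | no none = ⊥-elim (¬finer λ {x} {y} Mx≡My → decidable-stable (K x Finₚ.≟ K y) λ Kx≢Ky → none (x , y , Mx≡My , Kx≢Ky))

closer≤closer : ∀ {n} {α γ : Vec ℕ n} (Dα : IsDyck α) (Dγ : IsDyck γ) →
  Finer (closer Dα) (closer Dγ) → ∀ y → closer Dα y Fin.≤ closer Dγ y
closer≤closer Dα Dγ α⊑γ y = ≤-trans (y≤closer Dγ (closer Dα y)) (≤-reflexive (cong toℕ (α⊑γ (closer-idem Dα y))))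

module _ {n} {α γ : Vec ℕ n} (Dα : IsDyck α) (Dγ : IsDyck γ) where

  ≤K⇒finer : α ≤K γ → Finer (closer Dα) (closer Dγ)
  ≤K⇒finer (π , π′ , θπ≡α , θπ′≡γ , π≤π′) eq =
    sameClass⇒ (θπ≡α⇒closer-isClassMax Dγ π′ θπ′≡γ)
               (π≤π′ _ _ (⇒sameClass (θπ≡α⇒closer-isClassMax Dα π θπ≡α) eq))

  finer⇒≤K : Finer (closer Dα) (closer Dγ) → α ≤K γ
  finer⇒≤K finer = closerPartition Dα , closerPartition Dγ , θ-closerPartition Dα , θ-closerPartition Dγ , λ _ _ → finer

  finer-antisym : Finer (closer Dα) (closer Dγ) → Finer (closer Dγ) (closer Dα) → α ≡ γ
  finer-antisym α⊑γ γ⊑α = lookup-extensional α γ λ x →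
    trans (lookup-closer Dα x) (trans (count-cong (λ y → closer Dα y Finₚ.≟ x) (λ y → closer Dγ y Finₚ.≟ x)
                                                  (trans (sym (same _))) (trans (same _)))
                                      (sym (lookup-closer Dγ x)))
    where
    same : ∀ y → closer Dα y ≡ closer Dγ y
    same y = Finₚ.toℕ-injective (≤-antisym (closer≤closer Dα Dγ α⊑γ y) (closer≤closer Dγ Dα γ⊑α y))

-- Swapping a descent with the Dyck factor after it

-- In N S^α₁ ⋯ N S^αₙ this moves the descent S^αᵢ to the end of block j.
swap : ∀ {n} → Vec ℕ n → Fin n → Fin n → Vec ℕ n
swap α i j = α [ j ]≔ (lookup α i + lookup α j) [ i ]≔ 0

module _ {n} (α : Vec ℕ n) {i j : Fin n} (i≢j : i ≢ j) where

  private
    α′ = α [ j ]≔ (lookup α i + lookup α j)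

  lookup-swap-i : lookup (swap α i j) i ≡ 0
  lookup-swap-i = Vecₚ.lookup∘update i α′ 0

  lookup-swap-j : lookup (swap α i j) j ≡ lookup α i + lookup α j
  lookup-swap-j = trans (Vecₚ.lookup∘update′ (i≢j ∘ sym) α′ 0) (Vecₚ.lookup∘update j α _)

  lookup-swap-other : ∀ {k} → k ≢ i → k ≢ j → lookup (swap α i j) k ≡ lookup α k
  lookup-swap-other k≢i k≢j = trans (Vecₚ.lookup∘update′ k≢i α′ 0) (Vecₚ.lookup∘update′ k≢j α _)

  ≡swap⇔lookups : ∀ {β} → β ≡ swap α i j ⇔
    (lookup β i ≡ 0 × lookup β j ≡ lookup α i + lookup α j × (∀ k → k ≢ i → k ≢ j → lookup β k ≡ lookup α k))
  ≡swap⇔lookups {β} = mk⇔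
    (λ { refl → lookup-swap-i , lookup-swap-j , λ _ → lookup-swap-other })
    (λ (βi , βj , βk) → lookup-extensional β (swap α i j) λ k → pointwise k βi βj βk (k Finₚ.≟ i) (k Finₚ.≟ j))
    where
    pointwise : ∀ k → lookup β i ≡ 0 → lookup β j ≡ lookup α i + lookup α j →
      (∀ k → k ≢ i → k ≢ j → lookup β k ≡ lookup α k) → Dec (k ≡ i) → Dec (k ≡ j) → lookup β k ≡ lookup (swap α i j) k
    pointwise _ βi _  _  (yes refl) _          = trans βi (sym lookup-swap-i)
    pointwise _ _  βj _  (no _)     (yes refl) = trans βj (sym lookup-swap-j)
    pointwise k _  _  βk (no k≢i)   (no k≢j)   = trans (βk k k≢i k≢j) (sym (lookup-swap-other k≢i k≢j))

Precedes : ∀ {n} → Vec ℕ n → ℕ → ℕ → Set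
Precedes α i j = i ≤ j × height α j ≤ height α i × (∀ k → i < k → k < j → height α i ≤ height α k)

module _ {n} {α : Vec ℕ n} (D : IsDyck α) where

  private
    toHeights : ∀ i j → e α i ℤ.≤ e α j → height α i ≤ height α j
    toHeights i j ei≤ej = ℤₚ.drop‿+≤+ (subst₂ ℤ._≤_ (e≡height D i) (e≡height D j) ei≤ej)

    fromHeights : ∀ i j → height α i ≤ height α j → e α i ℤ.≤ e α j
    fromHeights i j hi≤hj = subst₂ ℤ._≤_ (sym (e≡height D i)) (sym (e≡height D j)) (ℤ.+≤+ hi≤hj)

  ⪯⇔Precedes : ∀ {i j} → i ⪯[ α ] j ⇔ Precedes α i j
  ⪯⇔Precedes {i} {j} = mk⇔
    (λ (i≤j , ej≤ei , above) → i≤j , toHeights j i ej≤ei , λ k i<k k<j → toHeights i k (above k i<k k<j))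
    (λ (i≤j , hj≤hi , above) → i≤j , fromHeights j i hj≤hi , λ k i<k k<j → fromHeights i k (above k i<k k<j))

redirect : ∀ {n} → Fin n → Fin n → Fin n → Fin n
redirect a b z with z Finₚ.≟ a
... | yes _ = b
... | no _  = z

redirect-source : ∀ {n} {a b z : Fin n} → z ≡ a → redirect a b z ≡ b
redirect-source {a = a} {z = z} z≡a with z Finₚ.≟ a
... | yes _   = refl
... | no z≢a  = ⊥-elim (z≢a z≡a)

redirect-other : ∀ {n} {a b z : Fin n} → z ≢ a → redirect a b z ≡ z
redirect-other {a = a} {z = z} z≢a with z Finₚ.≟ a
... | yes z≡a = ⊥-elim (z≢a z≡a)
... | no _    = refl

redirect-identifies : ∀ {n} {a b u v : Fin n} → redirect a b u ≡ redirect a b v → u ≢ v →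
  (u ≡ a × v ≡ b) ⊎ (u ≡ b × v ≡ a)
redirect-identifies {a = a} {b} {u} {v} eq u≢v = byCases (u Finₚ.≟ a) (v Finₚ.≟ a)
  where
  byCases : Dec (u ≡ a) → Dec (v ≡ a) → (u ≡ a × v ≡ b) ⊎ (u ≡ b × v ≡ a)
  byCases (yes u≡a) (yes v≡a) = ⊥-elim (u≢v (trans u≡a (sym v≡a)))
  byCases (yes u≡a) (no v≢a)  = inj₁ (u≡a , trans (sym (redirect-other v≢a)) (trans (sym eq) (redirect-source u≡a)))
  byCases (no u≢a)  (yes v≡a) = inj₂ (trans (sym (redirect-other u≢a)) (trans eq (redirect-source v≡a)) , v≡a)
  byCases (no u≢a)  (no v≢a)  = ⊥-elim (u≢v (trans (sym (redirect-other u≢a)) (trans eq (redirect-other v≢a))))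

module _ {n} {M K : Fin n → Fin n} {a b : Fin n} (K≗ : ∀ z → K z ≡ redirect a b (M z)) where

  finer-merge : Finer M K
  finer-merge {x} {y} Mx≡My = trans (K≗ x) (trans (cong (redirect a b) Mx≡My) (sym (K≗ y)))

  merge-identifies : ∀ {x y} → K x ≡ K y → M x ≢ M y → (M x ≡ a × M y ≡ b) ⊎ (M x ≡ b × M y ≡ a)
  merge-identifies {x} {y} Kx≡Ky = redirect-identifies (trans (sym (K≗ x)) (trans Kx≡Ky (K≗ y)))

  merge-finer : ∀ {L} → Finer M L → (∀ {x y} → M x ≡ a → M y ≡ b → L x ≡ L y) → Finer K L
  merge-finer {L} M⊑L joins {x} {y} Kx≡Ky with M x Finₚ.≟ M y
  ... | yes Mx≡My = M⊑L Mx≡My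
  ... | no Mx≢My with merge-identifies Kx≡Ky Mx≢My
  ...   | inj₁ (Mx≡a , My≡b) = joins Mx≡a My≡b
  ...   | inj₂ (Mx≡b , My≡a) = sym (joins My≡a Mx≡b)

module SwapDescent {n} {α : Vec ℕ n} (D : IsDyck α) {a b : Fin n} (a<b : a Fin.< b) where

  private
    γ = swap α a b
    A = toℕ a
    B = toℕ b
    αₐ = lookup α a
    a≢b : a ≢ b
    a≢b a≡b = <-irrefl (cong toℕ a≡b) a<b
    B<n : B < n
    B<n = Finₚ.toℕ<n b
    unchanged : ∀ {k} → toℕ k ≢ A → toℕ k ≢ B → lookup γ k ≡ lookup α k
    unchanged k≢A k≢B = lookup-swap-other α a≢b (k≢A ∘ cong toℕ) (k≢B ∘ cong toℕ)

  psum-before : ∀ m → m ≤ A → psum γ m ≡ psum α m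
  psum-before m m≤A = trans (sym (+-identityʳ _)) (psum-agree γ α z≤n (≤-trans m≤A (<⇒≤ (<-trans a<b B<n)))
    (λ x _ x<m → unchanged (<⇒≢ (<-≤-trans x<m m≤A)) (<⇒≢ (<-≤-trans x<m (<⇒≤ (≤-<-trans m≤A a<b)))))
    refl)

  psum-between : ∀ m → A < m → m ≤ B → psum γ m + αₐ ≡ psum α m
  psum-between m A<m m≤B = psum-agree γ α A<m (≤-trans m≤B (<⇒≤ B<n))
    (λ x A<x x<m → unchanged (<⇒≢ A<x ∘ sym) (<⇒≢ (<-≤-trans x<m m≤B)))
    (begin
      psum γ (suc A) + αₐ             ≡⟨ cong (_+ αₐ) (psum-suc γ a) ⟩
      psum γ A + lookup γ a + αₐ      ≡⟨ cong (λ t → psum γ A + t + αₐ) (lookup-swap-i α a≢b) ⟩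
      psum γ A + 0 + αₐ               ≡⟨ cong (_+ αₐ) (trans (+-identityʳ _) (psum-before A ≤-refl)) ⟩
      psum α A + αₐ                   ≡⟨ sym (psum-suc α a) ⟩
      psum α (suc A)                  ∎)
    where open ≡-Reasoning

  psum-after : ∀ m → B < m → m ≤ n → psum γ m ≡ psum α m
  psum-after m B<m m≤n = trans (sym (+-identityʳ _)) (psum-agree γ α B<m m≤n
    (λ x B<x _ → unchanged (<⇒≢ (<-trans a<b B<x) ∘ sym) (<⇒≢ B<x ∘ sym))
    (begin
      psum γ (suc B) + 0              ≡⟨ +-identityʳ _ ⟩
      psum γ (suc B)                  ≡⟨ psum-suc γ b ⟩
      psum γ B + lookup γ b           ≡⟨ cong (psum γ B +_) (lookup-swap-j α a≢b) ⟩
      psum γ B + (αₐ + lookup α b)    ≡⟨ sym (+-assoc (psum γ B) αₐ _) ⟩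
      psum γ B + αₐ + lookup α b      ≡⟨ cong (_+ lookup α b) (psum-between B a<b ≤-refl) ⟩
      psum α B + lookup α b           ≡⟨ sym (psum-suc α b) ⟩
      psum α (suc B)                  ∎))
    where open ≡-Reasoning

  psum-swap≤ : ∀ m → m ≤ n → psum γ m ≤ psum α m
  psum-swap≤ m m≤n with m ≤? A | m ≤? B
  ... | yes m≤A | _       = ≤-reflexive (psum-before m m≤A)
  ... | no m≰A  | yes m≤B = ≤-trans (m≤m+n _ αₐ) (≤-reflexive (psum-between m (≰⇒> m≰A) m≤B))
  ... | no _    | no m≰B  = ≤-reflexive (psum-after m (≰⇒> m≰B) m≤n)

  isDyck : IsDyck γ
  isDyck = (λ k k≤n → ≤-trans (psum-swap≤ k k≤n) (psum≤ D k)) , trans (psum-after n B<n ≤-refl) (proj₂ D)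

  height-before : ∀ m → m ≤ A → height γ m ≡ height α m
  height-before m m≤A = cong (m ∸_) (psum-before m m≤A)

  height-after : ∀ m → B < m → m ≤ n → height γ m ≡ height α m
  height-after m B<m m≤n = cong (m ∸_) (psum-after m B<m m≤n)

  height-between : ∀ m → A < m → m ≤ B → height γ m ≡ height α m + αₐ
  height-between m A<m m≤B = +-cancelʳ-≡ (psum γ m) _ _ (begin
    height γ m + psum γ m           ≡⟨ height+psum isDyck m ⟩
    m                               ≡⟨ sym (height+psum D m) ⟩
    height α m + psum α m           ≡⟨ cong (height α m +_) (sym (psum-between m A<m m≤B)) ⟩
    height α m + (psum γ m + αₐ)    ≡⟨ cong (height α m +_) (+-comm (psum γ m) αₐ) ⟩
    height α m + (αₐ + psum γ m)    ≡⟨ sym (+-assoc (height α m) αₐ (psum γ m)) ⟩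
    height α m + αₐ + psum γ m      ∎)
    where open ≡-Reasoning

  height≤height-swap : ∀ m → m ≤ n → height α m ≤ height γ m
  height≤height-swap m m≤n = ∸-monoʳ-≤ m (psum-swap≤ m m≤n)

  module _ (a⪯b : Precedes α (suc A) (suc B)) where

    private
      h = height α
      hγ = height γ
      c = closer D
      descends : h (suc B) ≤ h (suc A)
      descends = proj₁ (proj₂ a⪯b)
      staysAbove : ∀ m → suc A ≤ m → m ≤ B → h (suc A) ≤ h m
      staysAbove m A<m m≤B with m≤n⇒m<n∨m≡n A<m
      ... | inj₁ 1+A<m = proj₂ (proj₂ a⪯b) m 1+A<m (s≤s m≤B)
      ... | inj₂ refl  = ≤-refl
      climbs : h (suc A) + αₐ ≡ suc (h A)
      climbs = height-suc D a

    firstReturn-merged : ∀ y → c y ≡ a → FirstReturn γ (toℕ y) B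
    firstReturn-merged y cy≡a = firstReturn (<⇒≤ (≤-<-trans y≤A a<b)) returns′ stays-above′
      where
      R : FirstReturn α (toℕ y) A
      R = subst (λ d → FirstReturn α (toℕ y) (toℕ d)) cy≡a (closer-firstReturn D y)
      y≤A = start≤end R
      hy≡ : hγ (toℕ y) ≡ h (toℕ y)
      hy≡ = height-before (toℕ y) y≤A
      hy≤hA : h (toℕ y) ≤ h A
      hy≤hA with m≤n⇒m<n∨m≡n y≤A
      ... | inj₁ y<A = <⇒≤ (stays-above R A y<A ≤-refl)
      ... | inj₂ y≡A = ≤-reflexive (cong h y≡A)
      returns′ : hγ (suc B) ≤ hγ (toℕ y)
      returns′ = subst₂ _≤_ (sym (height-after (suc B) ≤-refl B<n)) (sym hy≡)
                        (≤-trans descends (returns R))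
      stays-above′ : ∀ m → toℕ y < m → m ≤ B → hγ (toℕ y) < hγ m
      stays-above′ m y<m m≤B with m ≤? A
      ... | yes m≤A = subst₂ _<_ (sym hy≡) (sym (height-before m m≤A)) (stays-above R m y<m m≤A)
      ... | no m≰A  = subst₂ _<_ (sym hy≡) (sym (height-between m (≰⇒> m≰A) m≤B))
                        (≤-trans (s≤s hy≤hA) (≤-trans (≤-reflexive (sym climbs))
                                                      (+-monoˡ-≤ αₐ (staysAbove m (≰⇒> m≰A) m≤B))))

    firstReturn-kept : ∀ y → c y ≢ a → FirstReturn γ (toℕ y) (toℕ (c y))
    firstReturn-kept y cy≢a = firstReturn y≤d returns′ stays-above′
      where
      R = closer-firstReturn D y
      d = toℕ (c y)
      y≤d = start≤end R
      d<n = Finₚ.toℕ<n (c y)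
      returns′ : hγ (suc d) ≤ hγ (toℕ y)
      returns′ with suc d ≤? A | B ≤? d
      ... | yes 1+d≤A | _ = subst₂ _≤_ (sym (height-before (suc d) 1+d≤A))
                              (sym (height-before (toℕ y) (≤-trans y≤d (<⇒≤ 1+d≤A)))) (returns R)
      ... | no _ | yes B≤d = ≤-trans (≤-reflexive (height-after (suc d) (s≤s B≤d) d<n))
                               (≤-trans (returns R) (height≤height-swap (toℕ y) (<⇒≤ (Finₚ.toℕ<n y))))
      ... | no 1+d≰A | no B≰d = inside (toℕ y ≤? A)
        where
        A<d : A < d
        A<d = ≤∧≢⇒< (≤-pred (≰⇒> 1+d≰A)) (λ A≡d → cy≢a (Finₚ.toℕ-injective (sym A≡d)))
        d<B : d < B
        d<B = ≰⇒> B≰d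
        inside : Dec (toℕ y ≤ A) → hγ (suc d) ≤ hγ (toℕ y)
        inside (yes y≤A) = ⊥-elim (<⇒≱ (<-≤-trans (stays-above R (suc A) (s≤s y≤A) A<d)
                                                  (staysAbove (suc d) (s≤s (<⇒≤ A<d)) d<B))
                                       (returns R))
        inside (no y≰A) = subst₂ _≤_ (sym (height-between (suc d) (s≤s (<⇒≤ A<d)) d<B))
                            (sym (height-between (toℕ y) (≰⇒> y≰A) (≤-trans y≤d (<⇒≤ d<B))))
                            (+-monoˡ-≤ αₐ (returns R))
      unchangedStart : ∀ {m} → hγ (toℕ y) ≡ h (toℕ y) → toℕ y < m → m ≤ d → hγ (toℕ y) < hγ m
      unchangedStart {m} eq y<m m≤d = <-≤-trans (subst (_< h m) (sym eq) (stays-above R m y<m m≤d))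
                                                (height≤height-swap m (≤-trans m≤d (<⇒≤ d<n)))
      stays-above′ : ∀ m → toℕ y < m → m ≤ d → hγ (toℕ y) < hγ m
      stays-above′ m y<m m≤d with toℕ y ≤? A | toℕ y ≤? B
      ... | yes y≤A | _       = unchangedStart (height-before (toℕ y) y≤A) y<m m≤d
      ... | no _    | no y≰B  = unchangedStart (height-after (toℕ y) (≰⇒> y≰B) (<⇒≤ (Finₚ.toℕ<n y))) y<m m≤d
      ... | no y≰A  | yes y≤B = shifted (m ≤? B)
        where
        A<y = ≰⇒> y≰A
        shifted : Dec (m ≤ B) → hγ (toℕ y) < hγ m
        shifted (yes m≤B) = subst₂ _<_ (sym (height-between (toℕ y) A<y y≤B)) (sym (height-between m (<-trans A<y y<m) m≤B))
                              (+-monoˡ-< αₐ (stays-above R m y<m m≤d))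
        shifted (no m≰B)  = ⊥-elim (<⇒≱ (stays-above R (suc B) (s≤s y≤B) (≤-trans (≰⇒> m≰B) m≤d))
                                        (≤-trans descends (staysAbove (toℕ y) A<y y≤B)))

    closer-swap : (Dγ : IsDyck γ) → ∀ y → closer Dγ y ≡ redirect a b (c y)
    closer-swap Dγ y with c y Finₚ.≟ a
    ... | yes cy≡a = closer-unique Dγ (firstReturn-merged y cy≡a)
    ... | no cy≢a  = closer-unique Dγ (firstReturn-kept y cy≢a)

-- Covers

swap⇒⋖K : ∀ {n} {α β : Vec ℕ n} (Dα : IsDyck α) (Dβ : IsDyck β) {i j : Fin n} → i Fin.< j → lookup α i > 0 →
  Precedes α (suc (toℕ i)) (suc (toℕ j)) → β ≡ swap α i j → α ⋖K β
swap⇒⋖K {α = α} Dα Dβ {i} {j} i<j αᵢ>0 i⪯j refl = (finer⇒≤K Dα Dβ (finer-merge βmerges) , α≢β) , noneBetween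
  where
  βmerges : ∀ z → closer Dβ z ≡ redirect i j (closer Dα z)
  βmerges = SwapDescent.closer-swap Dα i<j i⪯j Dβ
  α≢β : α ≢ swap α i j
  α≢β α≡β = <⇒≢ αᵢ>0 (sym (trans (cong (λ v → lookup v i) α≡β) (lookup-swap-i α (Finₚ.<⇒≢ i<j))))
  noneBetween : ¬ ∃ λ γ → IsDyck γ × α <K γ × γ <K swap α i j
  noneBetween (γ , Dγ , (α≤γ , α≢γ) , (γ≤β , γ≢β)) = γ≢β (finer-antisym Dγ Dβ γ⊑β β⊑γ)
    where
    α⊑γ = ≤K⇒finer Dα Dγ α≤γ
    γ⊑β = ≤K⇒finer Dγ Dβ γ≤β
    joins : ∀ {u v} → closer Dα u ≡ i → closer Dα v ≡ j → closer Dγ u ≡ closer Dγ v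
    joins {u} {v} cu≡i cv≡j with finer-witness (closer Dγ) (closer Dα) (α≢γ ∘ finer-antisym Dα Dγ α⊑γ)
    ... | x , y , cγx≡cγy , cαx≢cαy with merge-identifies βmerges (γ⊑β cγx≡cγy) cαx≢cαy
    ...   | inj₁ (cx≡i , cy≡j) = trans (α⊑γ (trans cu≡i (sym cx≡i))) (trans cγx≡cγy (α⊑γ (trans cy≡j (sym cv≡j))))
    ...   | inj₂ (cx≡j , cy≡i) = trans (α⊑γ (trans cu≡i (sym cy≡i))) (trans (sym cγx≡cγy) (α⊑γ (trans cx≡j (sym cv≡j))))
    β⊑γ : Finer (closer Dβ) (closer Dγ)
    β⊑γ = merge-finer βmerges α⊑γ joins

module StrictCoarsening {n} {α β : Vec ℕ n} (Dα : IsDyck α) (Dβ : IsDyck β)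
  (α⊑β : Finer (closer Dα) (closer Dβ)) (β⋢α : ¬ Finer (closer Dβ) (closer Dα)) where

  private
    cα = closer Dα
    cβ = closer Dβ
    h = height α
    witness = finer-witness cβ cα β⋢α
    x₀ = proj₁ witness
    y₀ = proj₁ (proj₂ witness)
    cβx₀≡cβy₀ = proj₁ (proj₂ (proj₂ witness))
    cαx₀≢cαy₀ = proj₂ (proj₂ (proj₂ witness))

  b : Fin n
  b = cβ x₀

  Stray : Pred (Fin n) 0ℓ
  Stray w = cβ w ≡ b × cα w ≢ b

  private
    stray? : Decidable Stray
    stray? w = (cβ w Finₚ.≟ b) ×-dec ¬? (cα w Finₚ.≟ b)

    someStray : Satisfiable Stray
    someStray with cα x₀ Finₚ.≟ b
    ... | yes cx₀≡b = y₀ , sym cβx₀≡cβy₀ , λ cy₀≡b → cαx₀≢cαy₀ (trans cx₀≡b (sym cy₀≡b))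
    ... | no cx₀≢b  = x₀ , refl , cx₀≢b

    largestStray = greatest stray? someStray

  a : Fin n
  a = proj₁ largestStray

  private
    A = toℕ a
    B = toℕ b
    cβa≡b : cβ a ≡ b
    cβa≡b = proj₁ (proj₁ (proj₂ largestStray))
    cαa≢b : cα a ≢ b
    cαa≢b = proj₂ (proj₁ (proj₂ largestStray))
    ≤a : ∀ {w} → Stray w → w Fin.≤ a
    ≤a = proj₂ (proj₂ largestStray)
    cβ∘cα : ∀ w → cβ (cα w) ≡ cβ w
    cβ∘cα w = α⊑β (closer-idem Dα w)
    cβb≡b : cβ b ≡ b
    cβb≡b = closer-idem Dβ x₀
    cα≤cβ : ∀ w → cα w Fin.≤ cβ w
    cα≤cβ = closer≤closer Dα Dβ α⊑β

  cαb≡b : cα b ≡ b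
  cαb≡b = Finₚ.toℕ-injective (≤-antisym (≤-trans (cα≤cβ b) (≤-reflexive (cong toℕ cβb≡b))) (y≤closer Dα b))

  cαa≡a : cα a ≡ a
  cαa≡a = Finₚ.toℕ-injective (≤-antisym (≤a cαaStray) (y≤closer Dα a))
    where
    cαaStray : Stray (cα a)
    cαaStray = trans (cβ∘cα a) cβa≡b , λ cαcαa≡b → cαa≢b (trans (sym (closer-idem Dα a)) cαcαa≡b)

  a<b : a Fin.< b
  a<b = Finₚ.≤∧≢⇒< (≤-trans (y≤closer Dβ a) (≤-reflexive (cong toℕ cβa≡b)))
                   λ a≡b → cαa≢b (trans (cong cα a≡b) cαb≡b)

  αₐ>0 : lookup α a > 0
  αₐ>0 = subst (0 <_) (sym (lookup-closer Dα a)) (count-satisfiable (λ y → cα y Finₚ.≟ a) (a , cαa≡a))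

  joins : ∀ {u v} → cα u ≡ a → cα v ≡ b → cβ u ≡ cβ v
  joins {u} {v} cu≡a cv≡b = trans (sym (cβ∘cα u)) (trans (cong cβ cu≡a) (trans cβa≡b
                              (sym (trans (sym (cβ∘cα v)) (trans (cong cβ cv≡b) cβb≡b)))))

  private
    nestedUnder-a : ∀ {z} → a Fin.≤ z → z Fin.≤ b → cβ z Fin.≤ b
    nestedUnder-a a≤z z≤b = subst (λ t → cβ _ Fin.≤ t) cβa≡b
                              (closer-nested Dβ a≤z (subst (λ t → _ Fin.≤ t) (sym cβa≡b) z≤b))

    descends : h (suc B) ≤ h (suc A)
    descends = subst₂ _≤_ (sym (height-closer Dα (suc B) (Finₚ.toℕ<n b)))
                          (sym (height-closer Dα (suc A) (<-trans a<b (Finₚ.toℕ<n b))))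
      (count-mono (open? cα (suc B)) (open? cα (suc A)) λ {z} (z<1+B , B<cz) →
        s≤s (≮⇒≥ λ A<z → <⇒≱ B<cz (≤-trans (cα≤cβ z) (nestedUnder-a (<⇒≤ A<z) (≤-pred z<1+B))))
        , <-trans a<b B<cz)

    staysAbove : ∀ k → suc A < k → k < suc B → h (suc A) ≤ h k
    staysAbove k 1+A<k k<1+B = subst₂ _≤_ (sym (height-closer Dα (suc A) (<-trans a<b (Finₚ.toℕ<n b))))
                                          (sym (height-closer Dα k (≤-trans (≤-pred k<1+B) (<⇒≤ (Finₚ.toℕ<n b)))))
      (count-mono (open? cα (suc A)) (open? cα k) λ {z} (z<1+A , A<cz) →
        <-trans z<1+A 1+A<k , ≮⇒≥ λ cz<k → notStray z (≤-pred z<1+A) A<cz (<-≤-trans cz<k (≤-pred k<1+B)))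
      where
      notStray : ∀ z → z Fin.≤ a → a Fin.< cα z → cα z Fin.< b → ⊥
      notStray z z≤a a<w w<b =
        <⇒≱ a<w (≤a (cβw≡b , λ cαw≡b → <-irrefl (cong toℕ (trans (sym (closer-idem Dα z)) cαw≡b)) w<b))
        where
        b≤cβz : b Fin.≤ cβ z
        b≤cβz = subst (Fin._≤ cβ z) cβa≡b (closer-nested Dβ z≤a (≤-trans (<⇒≤ a<w) (cα≤cβ z)))
        cβw≡b : cβ (cα z) ≡ b
        cβw≡b = Finₚ.toℕ-injective (≤-antisym (nestedUnder-a (<⇒≤ a<w) (<⇒≤ w<b))
                                              (subst (b Fin.≤_) (sym (cβ∘cα z)) b≤cβz))

  a⪯b : Precedes α (suc A) (suc B)
  a⪯b = s≤s (<⇒≤ a<b) , descends , staysAbove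

⋖K⇒swap : ∀ {n} {α β : Vec ℕ n} (Dα : IsDyck α) (Dβ : IsDyck β) → α ⋖K β →
  ∃₂ λ a b → a Fin.< b × lookup α a > 0 × Precedes α (suc (toℕ a)) (suc (toℕ b)) × β ≡ swap α a b
⋖K⇒swap {α = α} {β} Dα Dβ ((α≤β , α≢β) , noneBetween) = a , b , a<b , αₐ>0 , a⪯b , sym γ≡β
  where
  α⊑β = ≤K⇒finer Dα Dβ α≤β
  open StrictCoarsening Dα Dβ α⊑β (α≢β ∘ finer-antisym Dα Dβ α⊑β)
  γ = swap α a b
  Dγ = SwapDescent.isDyck Dα a<b
  γmerges : ∀ z → closer Dγ z ≡ redirect a b (closer Dα z)
  γmerges = SwapDescent.closer-swap Dα a<b a⪯b Dγ
  α<γ : α <K γ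
  α<γ = finer⇒≤K Dα Dγ (finer-merge γmerges) ,
        λ α≡γ → <⇒≢ αₐ>0 (sym (trans (cong (λ v → lookup v a) α≡γ) (lookup-swap-i α (Finₚ.<⇒≢ a<b))))
  γ≤β : γ ≤K β
  γ≤β = finer⇒≤K Dγ Dβ (merge-finer γmerges α⊑β joins)
  γ≡β : γ ≡ β
  γ≡β = decidable-stable (Vecₚ.≡-dec _≟_ γ β) λ γ≢β → noneBetween (γ , Dγ , α<γ , γ≤β , γ≢β)

DescentSwap : ∀ {n} → Vec ℕ n → Vec ℕ n → Fin n → Fin n → Set
DescentSwap α β i j = i Fin.< j × lookup α i > 0 × (suc (toℕ i) ⪯[ α ] suc (toℕ j)) ×
  lookup β i ≡ 0 × lookup β j ≡ lookup α i + lookup α j × (∀ k → k ≢ i → k ≢ j → lookup β k ≡ lookup α k)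

proposition2p3 : ∀ {n} (α β : Vec ℕ n) → IsDyck α → IsDyck β →
    (α ⋖K β) ⇔
    (∃ λ (i : Fin n) → ∃ λ (j : Fin n) →
      i Fin.< j × lookup α i > 0 × (suc (toℕ i) ⪯[ α ] suc (toℕ j)) ×
      lookup β i ≡ 0 × lookup β j ≡ lookup α i + lookup α j ×
      (∀ (k : Fin n) → k ≢ i → k ≢ j → lookup β k ≡ lookup α k))
proposition2p3 α β Dα Dβ = mk⇔ (fromSwap ∘ ⋖K⇒swap Dα Dβ) (λ (i , j , descentSwap) → toSwap descentSwap)
  where
  open Function.Bundles.Equivalence
  fromSwap : (∃₂ λ a b → a Fin.< b × lookup α a > 0 × Precedes α (suc (toℕ a)) (suc (toℕ b)) × β ≡ swap α a b) →
    ∃₂ (DescentSwap α β)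
  fromSwap (a , b , a<b , αₐ>0 , a⪯b , β≡swap) =
    a , b , a<b , αₐ>0 , from (⪯⇔Precedes Dα) a⪯b , to (≡swap⇔lookups α (Finₚ.<⇒≢ a<b)) β≡swap
  toSwap : ∀ {i j} → DescentSwap α β i j → α ⋖K β
  toSwap (i<j , αᵢ>0 , i⪯j , lookups) =
    swap⇒⋖K Dα Dβ i<j αᵢ>0 (to (⪯⇔Precedes Dα) i⪯j) (from (≡swap⇔lookups α (Finₚ.<⇒≢ i<j)) lookups)
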